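{- Let $(X,\mathcal{S},p)$ be a probability space, with $\pi xy$ iff $p(x)p(y)<p(x\cap y)$ and $U(a,b)=\{x\in\mathcal{S}:\pi ax\ \&\ \pi bx\}$. Call $c\in U(x,z)$ a $\pi$-supremum of $x,z$ if for every $h\in U(x,z)$, $h=c$ or $\pi ch$. Then (1) a $\pi$-supremum of a pair $x,z$ need not be unique; and (2) if $K$ is a $\pi$-ideal and $x,z\in K$, then every $\pi$-supremum $c$ of $x,z$ belongs to $K$.
   Context: A subset $K\subseteq\mathcal{S}$ is a $\pi$-ideal iff (i) for all $z\in K$ and $x\in\mathcal{S}$, $\pi zx$ implies $x\in K$; and (ii) for all $z,b\in K$, $U(z,b)\cap K\neq\emptyset$. -}

module Defs where

open import Level using (0ℓ)
open import Data.Nat using (ℕ; zero; suc) renaming (_≤_ to _≤ℕ_)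
open import Data.Unit using (⊤)
open import Data.Empty using (⊥)
open import Data.Product using (Σ; ∃; _×_; _,_; proj₁; proj₂)
open import Data.Sum using (_⊎_)
open import Relation.Nullary using (¬_)
open import Relation.Binary.PropositionalEquality using (_≢_)
open import Relation.Binary.Structures using (IsStrictPartialOrder)
open import Algebra.Structures using (IsCommutativeRing)
open import Function.Bundles using (_⇔_)

record Reals : Set₁ where
  infixl 6 _+_ _-_
  infixl 7 _*_
  infix 4 _≈_ _<_
  field
    R    : Set
    _≈_  : R → R → Set
    _+_  : R → R → R
    _*_  : R → R → R
    -_   : R → R
    0r   : R
    1r   : R
    _<_  : R → R → Set
    isCommutativeRing : IsCommutativeRing _≈_ _+_ _*_ -_ 0r 1r
    0≉1      : ¬ (0r ≈ 1r)
    inverse  : ∀ x → ¬ (x ≈ 0r) → ∃ λ y → x * y ≈ 1r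
    <-isStrictPartialOrder : IsStrictPartialOrder _≈_ _<_
    trichotomy : ∀ x y → x < y ⊎ (x ≈ y ⊎ y < x)
    +-mono-<  : ∀ {x y} z → x < y → x + z < y + z
    *-pos     : ∀ {x y} → 0r < x → 0r < y → 0r < x * y
    complete  : (P : R → Set) → ∃ P → (∃ λ b → ∀ x → P x → ¬ (b < x)) →
                ∃ λ s → (∀ x → P x → ¬ (s < x))
                      × (∀ b → (∀ x → P x → ¬ (b < x)) → ¬ (b < s))

  _-_ : R → R → R
  x - y = x + (- y)

module _ (ℝ : Reals) where
  open Reals ℝ

  partialSum : (ℕ → R) → ℕ → R
  partialSum a zero    = 0r
  partialSum a (suc n) = partialSum a n + a n

  SeriesConvergesTo : (ℕ → R) → R → Set
  SeriesConvergesTo a L =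
    ∀ ε → 0r < ε → ∃ λ N → ∀ n → N ≤ℕ n →
      (partialSum a n - L < ε) × (L - partialSum a n < ε)

  record ProbabilitySpace : Set₁ where
    field
      X      : Set
      𝒮      : (X → Set) → Set
      𝒮-ext  : ∀ {A B} → (∀ x → A x ⇔ B x) → 𝒮 A → 𝒮 B
      𝒮-full : 𝒮 (λ _ → ⊤)
      𝒮-compl : ∀ {A} → 𝒮 A → 𝒮 (λ x → ¬ A x)
      𝒮-inter : ∀ {A B} → 𝒮 A → 𝒮 B → 𝒮 (λ x → A x × B x)
      𝒮-union : (A : ℕ → X → Set) → (∀ n → 𝒮 (A n)) → 𝒮 (λ x → ∃ λ n → A n x)
      p      : (A : X → Set) → 𝒮 A → R
      p-ext  : ∀ {A B} (sA : 𝒮 A) (sB : 𝒮 B) → (∀ x → A x ⇔ B x) → p A sA ≈ p B sB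
      p-nonneg : ∀ A (sA : 𝒮 A) → ¬ (p A sA < 0r)
      p-full : p (λ _ → ⊤) 𝒮-full ≈ 1r
      p-σadd : (A : ℕ → X → Set) (sA : ∀ n → 𝒮 (A n)) →
               (∀ m n → m ≢ n → ∀ x → A m x → A n x → ⊥) →
               SeriesConvergesTo (λ n → p (A n) (sA n))
                                 (p (λ x → ∃ λ n → A n x) (𝒮-union A sA))

  module _ (P : ProbabilitySpace) where
    open ProbabilitySpace P

    Event : Set₁
    Event = Σ (X → Set) 𝒮

    prob : Event → R
    prob (A , sA) = p A sA

    _∩_ : Event → Event → Event
    (A , sA) ∩ (B , sB) = (λ x → A x × B x) , 𝒮-inter sA sB

    _≐_ : Event → Event → Set
    (A , _) ≐ (B , _) = ∀ x → A x ⇔ B x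

    π : Event → Event → Set
    π x y = prob x * prob y < prob (x ∩ y)

    U : Event → Event → Event → Set
    U a b x = π a x × π b x

    IsπSupremum : Event → Event → Event → Set₁
    IsπSupremum x z c = U x z c × (∀ h → U x z h → (h ≐ c) ⊎ π c h)

    IsπIdeal : (Event → Set) → Set₁
    IsπIdeal K = (∀ z x → K z → π z x → K x)
               × (∀ z b → K z → K b → ∃ λ h → U z b h × K h)

  πSupremumNotUnique : Set₁
  πSupremumNotUnique =
    Σ ProbabilitySpace λ P →
      ∃ λ x → ∃ λ z → ∃ λ c → ∃ λ c′ →
        IsπSupremum P x z c × IsπSupremum P x z c′ × ¬ (_≐_ P c c′)

  πIdealContainsπSuprema : Set₁
  πIdealContainsπSuprema =
    (P : ProbabilitySpace) (K : Event P → Set) → IsπIdeal P K →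
    ∀ x z → K x → K z → ∀ c → IsπSupremum P x z c → K c

-- Part (2) is immediate: a π-supremum c of x and z lies in U(x, z), so π x c, and π-ideals are
-- closed upwards along π. For part (1), any member of U(x, z) that is itself x (or z) is a
-- π-supremum, because every h ∈ U(x, z) satisfies π x h (and π z h). On three points a, b, c
-- with mass ½ at a and at c, the events {a} and {a, b} differ by a null point; every pair of
-- events that contain a but not c has π, since ½ · ½ < ½, so both events are π-suprema of
-- the pair ({a}, {a, b}), yet they are different. Countable additivity of such a discrete measure holds
-- because a disjoint family meets each atom at most once, so the partial sums are eventually
-- constant.
module Submission where

open import Defs
open import Level using (0ℓ)
open import Axiom.ExcludedMiddle using (ExcludedMiddle)
open import Algebra.Bundles using (CommutativeRing)
import Algebra.Properties.CommutativeSemigroup as CommutativeSemigroupProperties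
import Algebra.Properties.Ring as RingProperties
open import Data.Empty using (⊥; ⊥-elim)
open import Data.Nat using (ℕ; zero; suc; _≟_; _⊔_) renaming (_≤_ to _≤ℕ_; _<_ to _<ℕ_)
import Data.Nat.Properties as ℕ
open import Data.Product using (∃; _×_; _,_; proj₁; proj₂)
open import Data.Sum using (_⊎_; inj₁; inj₂; [_,_]′)
open import Data.Unit using (⊤; tt)
open import Function.Bundles using (_⇔_; mk⇔; Equivalence)
open import Relation.Binary.Structures using (IsStrictPartialOrder)
import Relation.Binary.Construct.StrictToNonStrict as StrictToNonStrict
import Relation.Binary.PropositionalEquality as ≡
open ≡ using (_≡_; _≢_)
import Relation.Binary.Reasoning.Setoid as SetoidReasoning
open import Relation.Nullary using (¬_; yes; no)
open import Relation.Nullary.Decidable using (toSum)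

module OrderedField (ℝ : Reals) where
  open Reals ℝ public

  ℝ-commutativeRing : CommutativeRing 0ℓ 0ℓ
  ℝ-commutativeRing = record { isCommutativeRing = isCommutativeRing }

  open CommutativeRing ℝ-commutativeRing public
    using (setoid; refl; sym; trans; +-cong; *-cong; -‿cong; +-identityˡ; +-identityʳ;
           *-identityˡ; *-identityʳ; distribˡ; distribʳ; -‿inverseʳ; zeroʳ; +-comm; ring)
  open RingProperties ring public using (-1*x≈-x; -‿involutive; -‿distribʳ-*)
  open IsStrictPartialOrder <-isStrictPartialOrder public
    using (irrefl; <-respʳ-≈; <-respˡ-≈) renaming (trans to <-trans)

  ≡⇒≈ : ∀ {u v} → u ≡ v → u ≈ v
  ≡⇒≈ ≡.refl = refl

  infix 4 _≤_
  _≤_ : R → R → Set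
  _≤_ = StrictToNonStrict._≤_ _≈_ _<_

  ≤-<-contradiction : ∀ {x} → 0r ≤ x → ¬ (x < 0r)
  ≤-<-contradiction 0≤x x<0 =
    irrefl refl (StrictToNonStrict.<-≤-trans _≈_ _<_ <-trans <-respʳ-≈ x<0 0≤x)

  neg⇒-pos : ∀ {x} → x < 0r → 0r < - x
  neg⇒-pos {x} x<0 =
    <-respˡ-≈ (-‿inverseʳ x) (<-respʳ-≈ (+-identityˡ (- x)) (+-mono-< (- x) x<0))

  <-+-pos : ∀ {a d} → 0r < d → a < a + d
  <-+-pos {a} {d} 0<d = <-respʳ-≈ (+-comm d a) (<-respˡ-≈ (+-identityˡ a) (+-mono-< a 0<d))

  pos+pos : ∀ {a b} → 0r < a → 0r < b → 0r < a + b
  pos+pos 0<a 0<b = <-trans 0<a (<-+-pos 0<b)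

  0≤+0≤ : ∀ {a b} → 0r ≤ a → 0r ≤ b → 0r ≤ a + b
  0≤+0≤ (inj₁ 0<a) (inj₁ 0<b) = inj₁ (pos+pos 0<a 0<b)
  0≤+0≤ {a} (inj₁ 0<a) (inj₂ 0≈b) =
    inj₁ (<-respʳ-≈ (trans (sym (+-identityʳ a)) (+-cong refl 0≈b)) 0<a)
  0≤+0≤ {b = b} (inj₂ 0≈a) 0≤b =
    StrictToNonStrict.trans _≈_ _<_ isEquivalence <-resp-≈ <-trans
      0≤b (inj₂ (trans (sym (+-identityˡ b)) (+-cong 0≈a refl)))
    where open IsStrictPartialOrder <-isStrictPartialOrder using (isEquivalence; <-resp-≈)

  -- If 1 < 0 then 0 < -1, and then 0 < (-1)(-1) = 1.
  0<1 : 0r < 1r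
  0<1 with trichotomy 0r 1r
  ... | inj₁ 0<1 = 0<1
  ... | inj₂ (inj₁ 0≈1) = ⊥-elim (0≉1 0≈1)
  ... | inj₂ (inj₂ 1<0) = ⊥-elim (irrefl refl (<-trans 0<1′ 1<0))
    where
    0<-1 : 0r < - 1r
    0<-1 = neg⇒-pos 1<0
    0<1′ : 0r < 1r
    0<1′ = <-respʳ-≈ (trans (-1*x≈-x (- 1r)) (-‿involutive 1r)) (*-pos 0<-1 0<-1)

  inverse-pos : ∀ {x y} → 0r < x → x * y ≈ 1r → 0r < y
  inverse-pos {x} {y} 0<x xy≈1 with trichotomy 0r y
  ... | inj₁ 0<y = 0<y
  ... | inj₂ (inj₁ 0≈y) = ⊥-elim (0≉1 (trans (sym (zeroʳ x)) (trans (*-cong refl 0≈y) xy≈1)))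
  ... | inj₂ (inj₂ y<0) = ⊥-elim (irrefl (sym (-‿inverseʳ 1r)) (pos+pos 0<1 0<-1))
    where
    0<-1 : 0r < - 1r
    0<-1 = <-respʳ-≈ (trans (sym (-‿distribʳ-* x y)) (-‿cong xy≈1)) (*-pos 0<x (neg⇒-pos y<0))

  two : R
  two = 1r + 1r

  0<two : 0r < two
  0<two = pos+pos 0<1 0<1

  two≉0 : ¬ (two ≈ 0r)
  two≉0 two≈0 = irrefl (sym two≈0) 0<two

  ½ : R
  ½ = proj₁ (inverse two two≉0)

  two*½≈1 : two * ½ ≈ 1r
  two*½≈1 = proj₂ (inverse two two≉0)

  0<½ : 0r < ½
  0<½ = inverse-pos 0<two two*½≈1

  ½+½≈1 : ½ + ½ ≈ 1r
  ½+½≈1 = begin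
    ½ + ½             ≈⟨ +-cong (*-identityˡ ½) (*-identityˡ ½) ⟨
    1r * ½ + 1r * ½   ≈⟨ distribʳ ½ 1r 1r ⟨
    two * ½           ≈⟨ two*½≈1 ⟩
    1r                ∎
    where open SetoidReasoning setoid

  ½*½<½ : ½ * ½ < ½
  ½*½<½ = <-respʳ-≈ ½*½+½*½≈½ (<-+-pos (*-pos 0<½ 0<½))
    where
    open SetoidReasoning setoid
    ½*½+½*½≈½ : ½ * ½ + ½ * ½ ≈ ½
    ½*½+½*½≈½ = begin
      ½ * ½ + ½ * ½   ≈⟨ distribˡ ½ ½ ½ ⟨
      ½ * (½ + ½)     ≈⟨ *-cong refl ½+½≈1 ⟩
      ½ * 1r          ≈⟨ *-identityʳ ½ ⟩
      ½               ∎

module Series (ℝ : Reals) where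
  open OrderedField ℝ
  open CommutativeSemigroupProperties
    (CommutativeRing.+-commutativeSemigroup ℝ-commutativeRing) using (interchange)

  SeriesEventuallyEquals : (ℕ → R) → R → Set
  SeriesEventuallyEquals a L = ∃ λ N → ∀ n → N ≤ℕ n → partialSum ℝ a n ≈ L

  eventuallyEquals⇒convergesTo : ∀ {a L} → SeriesEventuallyEquals a L → SeriesConvergesTo ℝ a L
  eventuallyEquals⇒convergesTo (N , sₙ≈L) ε 0<ε = N , λ n N≤n →
    <-respˡ-≈ (sym (trans (+-cong (sₙ≈L n N≤n) refl) (-‿inverseʳ _))) 0<ε ,
    <-respˡ-≈ (sym (trans (+-cong refl (-‿cong (sₙ≈L n N≤n))) (-‿inverseʳ _))) 0<ε

  partialSum-+ : ∀ (a b : ℕ → R) n →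
    partialSum ℝ (λ k → a k + b k) n ≈ partialSum ℝ a n + partialSum ℝ b n
  partialSum-+ a b zero    = sym (+-identityʳ 0r)
  partialSum-+ a b (suc n) =
    trans (+-cong (partialSum-+ a b n) refl) (interchange _ _ (a n) (b n))

  eventuallyEquals-+ : ∀ {a b L M} → SeriesEventuallyEquals a L → SeriesEventuallyEquals b M →
    SeriesEventuallyEquals (λ k → a k + b k) (L + M)
  eventuallyEquals-+ {a} {b} (N , sₙ≈L) (N′ , tₙ≈M) = N ⊔ N′ , λ n N⊔N′≤n →
    trans (partialSum-+ a b n)
          (+-cong (sₙ≈L n (ℕ.≤-trans (ℕ.m≤m⊔n N N′) N⊔N′≤n))
                  (tₙ≈M n (ℕ.≤-trans (ℕ.m≤n⊔m N N′) N⊔N′≤n)))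

module Indicator (em : ExcludedMiddle 0ℓ) (ℝ : Reals) where
  open OrderedField ℝ
  open Series ℝ

  indicator : R → Set → R
  indicator w Q with em {Q}
  ... | yes _ = w
  ... | no _  = 0r

  indicator-yes : ∀ w {Q} → Q → indicator w Q ≡ w
  indicator-yes w {Q} q with em {Q}
  ... | yes _ = ≡.refl
  ... | no ¬q = ⊥-elim (¬q q)

  indicator-no : ∀ w {Q} → ¬ Q → indicator w Q ≡ 0r
  indicator-no w {Q} ¬q with em {Q}
  ... | yes q = ⊥-elim (¬q q)
  ... | no _  = ≡.refl

  indicator-cong : ∀ w {Q Q′} → Q ⇔ Q′ → indicator w Q ≡ indicator w Q′
  indicator-cong w {Q} {Q′} Q⇔Q′ with em {Q} | em {Q′}
  ... | yes _ | yes _  = ≡.refl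
  ... | no _  | no _   = ≡.refl
  ... | yes q | no ¬q′ = ⊥-elim (¬q′ (Equivalence.to Q⇔Q′ q))
  ... | no ¬q | yes q′ = ⊥-elim (¬q (Equivalence.from Q⇔Q′ q′))

  indicator-nonneg : ∀ {w} Q → 0r ≤ w → 0r ≤ indicator w Q
  indicator-nonneg Q 0≤w with em {Q}
  ... | yes _ = 0≤w
  ... | no _  = inj₂ refl

  Exclusive : (ℕ → Set) → Set
  Exclusive Q = ∀ m n → m ≢ n → Q m → Q n → ⊥

  module _ (w : R) {Q : ℕ → Set} (exclusive : Exclusive Q) where

    OccursBefore : ℕ → Set
    OccursBefore n = ∃ λ k → k <ℕ n × Q k

    IndicatorStep : ℕ → Set
    IndicatorStep n =
      indicator w (OccursBefore n) + indicator w (Q n) ≈ indicator w (OccursBefore (suc n))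

    indicator-step-occurs : ∀ {n} → Q n → IndicatorStep n
    indicator-step-occurs {n} qₙ = begin
      indicator w (OccursBefore n) + indicator w (Q n)
        ≡⟨ ≡.cong₂ _+_ (indicator-no w notBefore) (indicator-yes w qₙ) ⟩
      0r + w
        ≈⟨ +-identityˡ w ⟩
      w
        ≡⟨ indicator-yes w (n , ℕ.n<1+n n , qₙ) ⟨
      indicator w (OccursBefore (suc n)) ∎
      where
      open SetoidReasoning setoid
      notBefore : ¬ OccursBefore n
      notBefore (k , k<n , qₖ) = exclusive k n (ℕ.<⇒≢ k<n) qₖ qₙ

    indicator-step-absent : ∀ {n} → ¬ Q n → IndicatorStep n
    indicator-step-absent {n} ¬qₙ = begin
      indicator w (OccursBefore n) + indicator w (Q n)
        ≡⟨ ≡.cong (indicator w (OccursBefore n) +_) (indicator-no w ¬qₙ) ⟩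
      indicator w (OccursBefore n) + 0r
        ≈⟨ +-identityʳ _ ⟩
      indicator w (OccursBefore n)
        ≡⟨ indicator-cong w (mk⇔ extend restrict) ⟩
      indicator w (OccursBefore (suc n)) ∎
      where
      open SetoidReasoning setoid
      extend : OccursBefore n → OccursBefore (suc n)
      extend (k , k<n , qₖ) = k , ℕ.m<n⇒m<1+n k<n , qₖ
      restrict : OccursBefore (suc n) → OccursBefore n
      restrict (k , k<1+n , qₖ) with ℕ.m<1+n⇒m<n∨m≡n k<1+n
      ... | inj₁ k<n    = k , k<n , qₖ
      ... | inj₂ ≡.refl = ⊥-elim (¬qₙ qₖ)

    partialSum-indicator : ∀ n →
      partialSum ℝ (λ k → indicator w (Q k)) n ≈ indicator w (OccursBefore n)
    partialSum-indicator zero    = ≡⇒≈ (≡.sym (indicator-no w λ ()))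
    partialSum-indicator (suc n) =
      trans (+-cong (partialSum-indicator n) refl)
            ([ indicator-step-occurs , indicator-step-absent ]′ (toSum (em {Q n})))

    -- By exclusivity an occurrence happens at a single index m, so after m it has been seen.
    eventuallyOccursBefore : ∃ λ N → ∀ n → N ≤ℕ n → ∃ Q → OccursBefore n
    eventuallyOccursBefore with em {∃ Q}
    ... | no ¬occurs = 0 , λ _ _ occurs → ⊥-elim (¬occurs occurs)
    ... | yes (m , qₘ) = suc m , λ n m<n (k , qₖ) → k , k<n n m<n k qₖ , qₖ
      where
      k<n : ∀ n → suc m ≤ℕ n → ∀ k → Q k → k <ℕ n
      k<n n m<n k qₖ with k ≟ m
      ... | yes ≡.refl = m<n
      ... | no k≢m    = ⊥-elim (exclusive k m k≢m qₖ qₘ)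

    indicator-series : SeriesEventuallyEquals (λ k → indicator w (Q k)) (indicator w (∃ Q))
    indicator-series = N , λ n N≤n →
      trans (partialSum-indicator n)
            (≡⇒≈ (indicator-cong w (mk⇔ (λ (k , _ , qₖ) → k , qₖ) (occurs n N≤n))))
      where
      N = proj₁ eventuallyOccursBefore
      occurs = proj₂ eventuallyOccursBefore

module TwoPointMasses (em : ExcludedMiddle 0ℓ) (ℝ : Reals) where
  open OrderedField ℝ
  open Series ℝ
  open Indicator em ℝ

  halfHalfSpace : (X : Set) → X → X → ProbabilitySpace ℝ
  halfHalfSpace X i j = record
    { X        = X
    ; 𝒮        = λ _ → ⊤
    ; 𝒮-ext    = λ _ _ → tt
    ; 𝒮-full   = tt
    ; 𝒮-compl  = λ _ → tt
    ; 𝒮-inter  = λ _ _ → tt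
    ; 𝒮-union  = λ _ _ → tt
    ; p        = λ A _ → mass A
    ; p-ext    = λ _ _ A⇔B →
        ≡⇒≈ (≡.cong₂ _+_ (indicator-cong ½ (A⇔B i)) (indicator-cong ½ (A⇔B j)))
    ; p-nonneg = λ A _ → ≤-<-contradiction
        (0≤+0≤ (indicator-nonneg (A i) (inj₁ 0<½)) (indicator-nonneg (A j) (inj₁ 0<½)))
    ; p-full   = trans (≡⇒≈ (≡.cong₂ _+_ (indicator-yes ½ tt) (indicator-yes ½ tt))) ½+½≈1
    ; p-σadd   = λ A _ disjoint → eventuallyEquals⇒convergesTo
        (eventuallyEquals-+ (indicator-series ½ λ m n m≢n → disjoint m n m≢n i)
                            (indicator-series ½ λ m n m≢n → disjoint m n m≢n j))
    }
    where
    mass : (X → Set) → R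
    mass A = indicator ½ (A i) + indicator ½ (A j)

module _ (ℝ : Reals) (P : ProbabilitySpace ℝ) where

  self-isπSupremumˡ : ∀ {x z} → U ℝ P x z x → IsπSupremum ℝ P x z x
  self-isπSupremumˡ x∈U = x∈U , λ _ (πxh , _) → inj₂ πxh

  self-isπSupremumʳ : ∀ {x z} → U ℝ P x z z → IsπSupremum ℝ P x z z
  self-isπSupremumʳ z∈U = z∈U , λ _ (_ , πzh) → inj₂ πzh

πIdeal-contains-πSuprema : (ℝ : Reals) → πIdealContainsπSuprema ℝ
πIdeal-contains-πSuprema ℝ P K (upward , _) x z Kx Kz c ((πxc , _) , _) = upward x c Kx πxc

module Counterexample (em : ExcludedMiddle 0ℓ) (ℝ : Reals) where
  open OrderedField ℝ
  open Indicator em ℝ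
  open TwoPointMasses em ℝ

  data Point : Set where
    a b c : Point

  space : ProbabilitySpace ℝ
  space = halfHalfSpace Point a c

  event : (Point → Set) → Event ℝ space
  event A = A , tt

  prob-½ : ∀ A → A a → ¬ A c → prob ℝ space (event A) ≈ ½
  prob-½ A aA ¬cA =
    trans (≡⇒≈ (≡.cong₂ _+_ (indicator-yes ½ aA) (indicator-no ½ ¬cA))) (+-identityʳ ½)

  π-of-prob-½ : ∀ A B → A a → B a → ¬ A c → ¬ B c → π ℝ space (event A) (event B)
  π-of-prob-½ A B aA aB ¬cA ¬cB =
    <-respʳ-≈ (sym (prob-½ (λ i → A i × B i) (aA , aB) (λ (cA , _) → ¬cA cA)))
      (<-respˡ-≈ (sym (*-cong (prob-½ A aA ¬cA) (prob-½ B aB ¬cB))) ½*½<½)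

  IsA IsAorB : Point → Set
  IsA i    = i ≡ a
  IsAorB i = i ≡ a ⊎ i ≡ b

  πSupremum-notUnique : πSupremumNotUnique ℝ
  πSupremum-notUnique = space , x , z , x , z ,
    self-isπSupremumˡ ℝ space {x} {z}
      (π-of-prob-½ IsA IsA aA aA ¬cA ¬cA , π-of-prob-½ IsAorB IsA aAB aA ¬cAB ¬cA) ,
    self-isπSupremumʳ ℝ space {x} {z}
      (π-of-prob-½ IsA IsAorB aA aAB ¬cA ¬cAB , π-of-prob-½ IsAorB IsAorB aAB aAB ¬cAB ¬cAB) ,
    λ x≐z → b≢a (Equivalence.from (x≐z b) (inj₂ ≡.refl))
    where
    x z : Event ℝ space
    x = event IsA
    z = event IsAorB
    aA : IsA a
    aA = ≡.refl
    aAB : IsAorB a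
    aAB = inj₁ ≡.refl
    ¬cA : ¬ IsA c
    ¬cA ()
    ¬cAB : ¬ IsAorB c
    ¬cAB (inj₁ ())
    ¬cAB (inj₂ ())
    b≢a : ¬ IsA b
    b≢a ()

mainTheorem5 : ExcludedMiddle 0ℓ → (ℝ : Reals) →
    πSupremumNotUnique ℝ × πIdealContainsπSuprema ℝ
mainTheorem5 em ℝ = Counterexample.πSupremum-notUnique em ℝ , πIdeal-contains-πSuprema ℝ
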